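{- Let $\mathbb H$ be a connected linear graph and let $\mathbf H = \operatorname{rel}(\mathbb H)$ be its tree order relaxation. Then for every pair of vertices $x, y \in V(\mathbf H)$ it holds that $x \preccurlyeq_{\mathbf H} y$ if and only if there exists an $x$-$y$-path $P$ in $H$ whose $\preccurlyeq_{\mathbf H}$-minimum vertex is $x$ (i.e. $x \preccurlyeq_{\mathbf H} u$ for all $u \in V(P)$).
   Context: A tree order on a finite set $S$ is a partial order $\preccurlyeq$ such that for every $x \in S$ the set $\{y : y \preccurlyeq x\}$ is totally ordered by $\preccurlyeq$. A tree-ordered graph (tog) $\mathbf G = (G, \preccurlyeq_{\mathbf G})$ is a finite graph $G$ together with a tree order $\preccurlyeq_{\mathbf G}$ on $V(G)$ such that for every edge $uv \in E(G)$ either $u \preccurlyeq_{\mathbf G} v$ or $v \preccurlyeq_{\mathbf G} u$. If the order is total, the tog is a linear graph. For a connected linear graph $\mathbb H$ (graph $H$ with a linear order of its vertices), its elimination tree $\operatorname{ET}(\mathbb H)$ is defined recursively: let $x$ be the minimum vertex of $\mathbb H$ and $\mathbb K_1, \dots, \mathbb K_s$ the connected components of $\mathbb H - x$ (with the induced order); then $\operatorname{ET}(\mathbb H)$ is the rooted tree with root $x$ whose children are the roots of $\operatorname{ET}(\mathbb K_1), \dots, \operatorname{ET}(\mathbb K_s)$. The tree order relaxation $\operatorname{rel}(\mathbb H)$ is the tog $(H, \preccurlyeq)$ where $u \preccurlyeq v$ iff $u$ lies on the path from the root of $\operatorname{ET}(\mathbb H)$ to $v$ (i.e. $u$ is an ancestor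 of $v$ or $u = v$). -}

module Defs where

open import Level using (0ℓ)
open import Data.Nat using (ℕ)
open import Data.Fin using (Fin; _≤_)
open import Data.List using (List; []; _∷_)
open import Data.List.Relation.Unary.All using (All)
open import Data.List.Relation.Unary.Unique.Propositional using (Unique)
open import Data.List.Membership.Propositional using (_∈_)
open import Data.Product using (Σ; _×_; ∃)
open import Data.Unit using (⊤)
open import Relation.Binary.PropositionalEquality using (_≡_; _≢_)
open import Relation.Nullary using (¬_)

-- A linear graph is such a
-- graph together with a linear order on its vertices; since every finite
-- linear order is isomorphic to some Fin n with its natural order, we take
-- the vertex order to be the natural order _≤_ on Fin n.
record LinearGraph (n : ℕ) : Set₁ where
  field
    Adj    : Fin n → Fin n → Set
    sym    : ∀ {u v} → Adj u v → Adj v u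
    irrefl : ∀ {u} → ¬ Adj u u

module _ {n : ℕ} (G : LinearGraph n) where
  open LinearGraph G

  data Walk : Fin n → Fin n → List (Fin n) → Set where
    here  : ∀ {x} → Walk x x (x ∷ [])
    step  : ∀ {x z y vs} → Adj x z → Walk z y vs → Walk x y (x ∷ vs)

  IsPath : Fin n → Fin n → List (Fin n) → Set
  IsPath x y vs = Walk x y vs × Unique vs

  VSet : Set₁
  VSet = Fin n → Set

  ReachIn : VSet → Fin n → Fin n → Set
  ReachIn T x y = Σ (List (Fin n)) (λ vs → Walk x y vs × All T vs)

  Connected : Set
  Connected = ∀ u v → ReachIn (λ _ → ⊤) u v

  IsMin : VSet → Fin n → Set
  IsMin S x = S x × (∀ z → S z → x ≤ z)

  CompWithout : VSet → Fin n → Fin n → VSet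
  CompWithout S x w z = S z × z ≢ x × ReachIn (λ t → S t × t ≢ x) w z

  -- ETAnc S u v : u is an ancestor of v (or u = v) in the elimination tree
  -- ET(G[S]) of the (connected) induced linear graph G[S].  This follows the
  -- recursive definition: the root is the minimum x of S and its subtrees are
  -- the elimination trees of the components of G[S] - x.
  data ETAnc : VSet → Fin n → Fin n → Set₁ where
    root : ∀ {S x v} → IsMin S x → S v → ETAnc S x v
    sub  : ∀ {S x w u v} → IsMin S x → S w → w ≢ x →
           ETAnc (CompWithout S x w) u v → ETAnc S u v

  RelLeq : Fin n → Fin n → Set₁
  RelLeq = ETAnc (λ _ → ⊤)

module Submission where

-- The backward direction is immediate: y lies on the path, and
-- every vertex of the path is a descendant of x.  For the forward direction
-- we prove, by induction on the derivation of  ETAnc S x y,  that whenever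
-- G[S] is connected, x is joined to y by a walk inside G[S] all of whose
-- vertices are descendants of x in ET(G[S]):
--   * at the root x = min S, connectivity of G[S] gives a walk, and every
--     vertex of S is a descendant of the root;
--   * in a subtree we recurse into the component C of G[S] - min S, which is
--     always connected, and descendants in ET(C) are descendants in ET(G[S]).
-- Finally every walk can be shortened to a path through a subset of its
-- vertices, which keeps the "descendant of x" property.

open import Defs
open import Data.Nat using (ℕ)
open import Data.Fin using (Fin; _≟_)
open import Data.List using (List; []; _∷_)
open import Data.List.Membership.Propositional using (_∈_)
open import Data.List.Relation.Unary.All as All using (All; []; _∷_)
open import Data.List.Relation.Unary.Any using (here; there)
open import Data.List.Relation.Unary.AllPairs using ([]; _∷_)
open import Data.List.Relation.Unary.Unique.Propositional using (Unique)
open import Data.Product using (Σ; _×_; _,_)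
open import Data.Sum using (_⊎_; inj₁; inj₂)
open import Relation.Binary.PropositionalEquality using (_≢_; refl)
open import Relation.Nullary using (yes; no)
open import Function.Bundles using (_⇔_; mk⇔)

module Walks {n : ℕ} (G : LinearGraph n) where
  open LinearGraph G using (Adj) renaming (sym to Adj-sym)

  -- A walk from a to b all of whose vertices satisfy P.  This is ReachIn
  -- generalised to predicates of any level, since the descendant relation
  -- ETAnc lives in Set₁.
  WalkIn : ∀ {ℓ} → (Fin n → Set ℓ) → Fin n → Fin n → Set ℓ
  WalkIn P a b = Σ (List (Fin n)) (λ vs → Walk G a b vs × All P vs)

  PathIn : ∀ {ℓ} → (Fin n → Set ℓ) → Fin n → Fin n → Set ℓ
  PathIn P a b = Σ (List (Fin n)) (λ vs → IsPath G a b vs × All P vs)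

  start-satisfies : ∀ {ℓ} {P : Fin n → Set ℓ} {a b vs} →
                    Walk G a b vs → All P vs → P a
  start-satisfies here       (pa ∷ _) = pa
  start-satisfies (step _ _) (pa ∷ _) = pa

  end∈walk : ∀ {a b vs} → Walk G a b vs → b ∈ vs
  end∈walk here       = here refl
  end∈walk (step _ w) = there (end∈walk w)

  _++ᵂ_ : ∀ {ℓ} {P : Fin n → Set ℓ} {a b c} →
          WalkIn P a b → WalkIn P b c → WalkIn P a c
  (_ , here , _ ∷ _) ++ᵂ r = r
  (_ , step adj w , pa ∷ ps) ++ᵂ r with (_ , w , ps) ++ᵂ r
  ... | vs , w′ , ps′ = _ ∷ vs , step adj w′ , pa ∷ ps′

  edgeWalk : ∀ {ℓ} {P : Fin n → Set ℓ} {a b} → Adj a b → P a → P b → WalkIn P a b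
  edgeWalk adj pa pb = _ , step adj here , pa ∷ pb ∷ []

  reverseᵂ : ∀ {ℓ} {P : Fin n → Set ℓ} {a b} → WalkIn P a b → WalkIn P b a
  reverseᵂ (_ , here , ps) = _ , here , ps
  reverseᵂ (_ , step adj w , pa ∷ ps) =
    reverseᵂ (_ , w , ps) ++ᵂ edgeWalk (Adj-sym adj) (start-satisfies w ps) pa

  weakenᵂ : ∀ {ℓ ℓ′} {P : Fin n → Set ℓ} {Q : Fin n → Set ℓ′} →
            (∀ {u} → P u → Q u) → ∀ {a b} → WalkIn P a b → WalkIn Q a b
  weakenᵂ f (vs , w , ps) = vs , w , All.map f ps

module Components {n : ℕ} (G : LinearGraph n) where
  open Walks G

  ConnectedIn : VSet G → Set
  ConnectedIn S = ∀ u v → S u → S v → WalkIn S u v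

  reach-along : ∀ {T : VSet G} {w z z′ vs} → WalkIn T w z → Walk G z z′ vs →
                All T vs → All (WalkIn T w) vs
  reach-along r here (_ ∷ []) = r ∷ []
  reach-along r (step adj walk) (t ∷ ts) =
    r ∷ reach-along (r ++ᵂ edgeWalk adj t (start-satisfies walk ts)) walk ts

  -- The component of G[S] - x containing w is connected (for any S): join
  -- u and v through w; every vertex on the way stays reachable from w.
  component-connected : ∀ S x w → ConnectedIn (CompWithout G S x w)
  component-connected S x w u v (_ , _ , w⇝u) (_ , _ , w⇝v)
    with reverseᵂ w⇝u ++ᵂ w⇝v
  ... | vs , walk , ts =
    vs , walk , All.zipWith (λ { ((sz , z≢x) , w⇝z) → sz , z≢x , w⇝z })
                            (ts , reach-along w⇝u walk ts)

  descendant-walk : ∀ {S x y} → ConnectedIn S → ETAnc G S x y →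
                    WalkIn (ETAnc G S x) x y
  descendant-walk conn (root (sx , minimal) sy) =
    weakenᵂ (root (sx , minimal)) (conn _ _ sx sy)
  descendant-walk {S} _ (sub {x = m} {w = w} isMin sw w≢m e) =
    weakenᵂ (sub isMin sw w≢m)
            (descendant-walk (component-connected S m w) e)

module Shortening {n : ℕ} (G : LinearGraph n) where
  open Walks G

  ∈-or-∉ : (x : Fin n) (ws : List (Fin n)) → x ∈ ws ⊎ All (x ≢_) ws
  ∈-or-∉ x [] = inj₂ []
  ∈-or-∉ x (y ∷ ws) with x ≟ y | ∈-or-∉ x ws
  ... | yes x≡y | _       = inj₁ (here x≡y)
  ... | no  _   | inj₁ x∈ = inj₁ (there x∈)
  ... | no  x≢y | inj₂ x∉ = inj₂ (x≢y ∷ x∉)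

  suffix-path : ∀ {ℓ} {P : Fin n → Set ℓ} {x z y ws} → Walk G z y ws →
                Unique ws → All P ws → x ∈ ws → PathIn P x y
  suffix-path here         u ps (here refl) = _ , (here , u) , ps
  suffix-path (step adj w) u ps (here refl) = _ , (step adj w , u) , ps
  suffix-path (step _ w) (_ ∷ u) (_ ∷ ps) (there x∈) = suffix-path w u ps x∈

  -- Every walk inside P can be shortened to a path inside P: shorten the
  -- tail, then either prepend x or, if x recurs, cut at its occurrence.
  walk⇒path : ∀ {ℓ} {P : Fin n → Set ℓ} {x y} → WalkIn P x y → PathIn P x y
  walk⇒path (_ , here , ps) = _ , (here , [] ∷ []) , ps
  walk⇒path {x = x} (_ , step adj w , px ∷ ps) with walk⇒path (_ , w , ps)
  ... | ws , (w′ , u) , ps′ with ∈-or-∉ x ws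
  ...   | inj₁ x∈ = suffix-path w′ u ps′ x∈
  ...   | inj₂ x∉ = _ , (step adj w′ , x∉ ∷ u) , px ∷ ps′

lemma1 : ∀ {n} (G : LinearGraph n) → Connected G → (x y : Fin n) →
    RelLeq G x y ⇔ Σ (List (Fin n)) (λ vs → IsPath G x y vs × (∀ u → u ∈ vs → RelLeq G x u))
lemma1 G conn x y = mk⇔ to from
  where
  open Walks G
  open Components G
  open Shortening G

  PathThroughDescendants : Set₁
  PathThroughDescendants =
    Σ (List (Fin _)) (λ vs → IsPath G x y vs × (∀ u → u ∈ vs → RelLeq G x u))

  to : RelLeq G x y → PathThroughDescendants
  to x≼y with walk⇒path (descendant-walk (λ u v _ _ → conn u v) x≼y)
  ... | vs , path , descendants = vs , path , λ _ u∈ → All.lookup descendants u∈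

  from : PathThroughDescendants → RelLeq G x y
  from (vs , (walk , _) , descendants) = descendants y (end∈walk walk)
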